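{- For ordinals $A, B, C : \mathsf{Ord}$: if $A < B$ and $B \leq C$ then $A < C$. Moreover, the statement "for all $A, B, C : \mathsf{Ord}$, if $A \leq B$ and $B < C$ then $A < C$" holds if and only if the law of excluded middle holds.
   Context: Work in homotopy type theory (univalent). The law of excluded middle ($\mathsf{LEM}$) states that for every proposition $P$, $P \uplus \neg P$. $\mathsf{Ord}$ is the type of pairs $(X, \prec)$ with $X$ a type (in a fixed universe) and $\prec\, : X \to X \to \mathsf{hProp}$ which is extensional ($\forall a b.\,(\forall c.\, c \prec a \leftrightarrow c \prec b) \to b = a$), wellfounded (every element is accessible, accessibility being inductively defined: $x$ is accessible if every $y \prec x$ is), and transitive. A simulation $f : X \to Y$ between $(X,\prec_X)$ and $(Y,\prec_Y)$ is a function which is monotone ($x_1 \prec_X x_2 \to f x_1 \prec_Y f x_2$) and such that for all $x : X$, $y : Y$ with $y \prec_Y f x$ there is $x_0 \prec_X x$ with $f x_0 = y$; $X \leq Y$ is the type of simulations. For $y : Y$, $Y_{/y} := \Sigma(y' : Y).\, y' \prec_Y y$ with the restricted order. A simulation $f$ is bounded if there is $y : Y$ such that $f$ induces an equivalence $X \simeq Y_{/y}$; $X < Y$ is the type of bounded simulations. -}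

module Defs where

open import Level using (Level; _⊔_; suc)
open import Data.Product using (Σ; Σ-syntax; _×_; _,_; proj₁; proj₂)
open import Data.Sum using (_⊎_)
open import Relation.Nullary using (¬_)
open import Relation.Binary.PropositionalEquality using (_≡_)
open import Induction.WellFounded using (WellFounded)
open import Relation.Binary.Definitions using (Transitive)

isProp : ∀ {ℓ} → Set ℓ → Set ℓ
isProp P = (p q : P) → p ≡ q

LEM : (ℓ : Level) → Set (suc ℓ)
LEM ℓ = (P : Set ℓ) → isProp P → P ⊎ ¬ P

isEquiv : ∀ {a b} {A : Set a} {B : Set b} → (A → B) → Set (a ⊔ b)
isEquiv {A = A} {B} f =
  (Σ[ g ∈ (B → A) ] (∀ x → g (f x) ≡ x)) × (Σ[ h ∈ (B → A) ] (∀ y → f (h y) ≡ y))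

record Ord (ℓ : Level) : Set (suc ℓ) where
  field
    Car   : Set ℓ
    _≺_   : Car → Car → Set ℓ
    ≺-prop : ∀ a b → isProp (a ≺ b)
    ext   : ∀ a b → (∀ c → (c ≺ a → c ≺ b) × (c ≺ b → c ≺ a)) → b ≡ a
    wf    : WellFounded _≺_
    trans : Transitive _≺_

open Ord public

isSimulation : ∀ {ℓ} (X Y : Ord ℓ) → (Car X → Car Y) → Set ℓ
isSimulation X Y f =
  (∀ x₁ x₂ → _≺_ X x₁ x₂ → _≺_ Y (f x₁) (f x₂)) ×
  (∀ x y → _≺_ Y y (f x) → Σ[ x₀ ∈ Car X ] (_≺_ X x₀ x × f x₀ ≡ y))

_≤ₒ_ : ∀ {ℓ} → Ord ℓ → Ord ℓ → Set ℓ
X ≤ₒ Y = Σ[ f ∈ (Car X → Car Y) ] isSimulation X Y f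

-- Initial segment  Y/y  (carrier only; the order is the restriction)
Seg : ∀ {ℓ} (Y : Ord ℓ) → Car Y → Set ℓ
Seg Y y = Σ[ y' ∈ Car Y ] _≺_ Y y' y

isBounded : ∀ {ℓ} (X Y : Ord ℓ) → (Car X → Car Y) → Set ℓ
isBounded X Y f =
  Σ[ y ∈ Car Y ] Σ[ h ∈ (∀ x → _≺_ Y (f x) y) ] isEquiv {A = Car X} {B = Seg Y y} (λ x → f x , h x)

_<ₒ_ : ∀ {ℓ} → Ord ℓ → Ord ℓ → Set ℓ
X <ₒ Y = Σ[ f ∈ (Car X → Car Y) ] (isSimulation X Y f × isBounded X Y f)

{-# OPTIONS --safe #-}
module Submission where

-- A simulation whose image is exactly an initial segment Y/y is bounded at y, since
-- simulations are injective; and a simulation g maps such a segment image onto Z/(g y).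
-- This gives A < B ≤ C ⇒ A < C constructively. For A ≤ B < C one needs the image of
-- A ≤ B to be all of B or a segment B/b, b the least element outside the image: this
-- case distinction is what LEM provides. Conversely, for a proposition P, the ordinals
-- P ≤ 𝟙 < 𝟚 give a bounded simulation P < 𝟚 whose bound (false or true) decides P.

open import Defs
open import Level using (Level; _⊔_; Lift; lift)
open import Data.Product using (Σ-syntax; _×_; _,_; proj₁; proj₂)
open import Data.Sum using (_⊎_; inj₁; inj₂)
open import Data.Empty using (⊥-elim)
open import Data.Empty.Polymorphic using (⊥)
open import Data.Unit.Polymorphic using (⊤)
open import Data.Bool using (Bool; true; false; f<t) renaming (_<_ to _<ᵇ_)
open import Data.Bool.Properties using (T-irrelevant; <-irrelevant; <-trans)
open import Function using (_∘_)
open import Relation.Nullary using (¬_; Dec; yes; no)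
open import Relation.Nullary.Decidable
  using (False; fromSum; map′; toWitnessFalse; fromWitnessFalse; decidable-stable)
open import Relation.Binary.PropositionalEquality using (_≡_; refl; sym; cong; subst)
  renaming (trans to ≡-trans)
open import Induction.WellFounded using (Acc; acc; WfRec; module All)
open import Function.Bundles using (_⇔_; mk⇔)
open import Axiom.UniquenessOfIdentityProofs using (module Decidable⇒UIP)

fiber : ∀ {a b} {A : Set a} {B : Set b} → (A → B) → B → Set (a ⊔ b)
fiber {A = A} f y = Σ[ x ∈ A ] f x ≡ y

module _ {ℓ} (X : Ord ℓ) where

  ≺-rec : ∀ {p} (P : Car X → Set p) → (∀ x → WfRec (_≺_ X) P x → P x) → ∀ x → P x
  ≺-rec {p} = All.wfRec (wf X) p

  ≺-irrefl : ∀ x → ¬ _≺_ X x x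
  ≺-irrefl = ≺-rec _ λ x ih x≺x → ih x≺x x≺x

  Seg-≡ : ∀ {y a b} {p : _≺_ X a y} {q : _≺_ X b y} → a ≡ b → _≡_ {A = Seg X y} (a , p) (b , q)
  Seg-≡ {y} {a} {p = p} {q} refl = cong (a ,_) (≺-prop X a y p q)

module _ {ℓ} (X Y : Ord ℓ) {f : Car X → Car Y} (f-sim : isSimulation X Y f) where

  private
    _<_ = _≺_ X
    mono = proj₁ f-sim
    sim = proj₂ f-sim

  simulation-injective : ∀ x x′ → f x ≡ f x′ → x ≡ x′
  simulation-injective = ≺-rec X (λ x → ∀ x′ → f x ≡ f x′ → x ≡ x′) step
    where
    step : ∀ x → WfRec _<_ (λ x → ∀ x′ → f x ≡ f x′ → x ≡ x′) x → ∀ x′ → f x ≡ f x′ → x ≡ x′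
    step x ih x′ e = sym (ext X x x′ λ c → into c , out c)
      where
      into : ∀ c → c < x → c < x′
      into c c<x with sim x′ (f c) (subst (_≺_ Y (f c)) e (mono c x c<x))
      ... | c′ , c′<x′ , fc′≡fc = subst (_< x′) (sym (ih c<x c′ (sym fc′≡fc))) c′<x′
      out : ∀ c → c < x′ → c < x
      out c c<x′ with sim x (f c) (subst (_≺_ Y (f c)) (sym e) (mono c x′ c<x′))
      ... | c′ , c′<x , fc′≡fc = subst (_< x) (ih c′<x c fc′≡fc) c′<x

  simulation-∘ : ∀ (Z : Ord ℓ) {g : Car Y → Car Z} → isSimulation Y Z g → isSimulation X Z (g ∘ f)
  simulation-∘ Z {g = g} (g-mono , g-lift) =
    (λ x₁ x₂ → g-mono _ _ ∘ mono x₁ x₂) ,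
    λ x z z≺gfx → let (y , y≺fx , gy≡z) = g-lift (f x) z z≺gfx
                      (x₀ , x₀<x , fx₀≡y) = sim x y y≺fx
                  in x₀ , x₀<x , ≡-trans (cong g fx₀≡y) gy≡z

SegmentImage : ∀ {a ℓ} {A : Set a} (Y : Ord ℓ) → (A → Car Y) → Car Y → Set (a ⊔ ℓ)
SegmentImage Y f y = (∀ x → _≺_ Y (f x) y) × (∀ {z} → _≺_ Y z y → fiber f z)

module _ {ℓ} (X Y : Ord ℓ) {f : Car X → Car Y} where

  bounded⇒SegmentImage : (f-bdd : isBounded X Y f) → SegmentImage Y f (proj₁ f-bdd)
  bounded⇒SegmentImage (y , f≺y , _ , (inv , inv-section)) =
    f≺y , λ {z} z≺y → inv (z , z≺y) , cong proj₁ (inv-section (z , z≺y))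

  SegmentImage⇒<ₒ : isSimulation X Y f → ∀ {y} → SegmentImage Y f y → X <ₒ Y
  SegmentImage⇒<ₒ f-sim {y} (f≺y , cover) =
    f , f-sim , y , f≺y , (inv , retraction) , (inv , section)
    where
    inv : Seg Y y → Car X
    inv (z , z≺y) = proj₁ (cover z≺y)
    retraction : ∀ x → inv (f x , f≺y x) ≡ x
    retraction x = simulation-injective X Y f-sim _ _ (proj₂ (cover (f≺y x)))
    section : ∀ s → (f (inv s) , f≺y (inv s)) ≡ s
    section (z , z≺y) = Seg-≡ Y (proj₂ (cover z≺y))

module _ {ℓ} {A : Set ℓ} (Y Z : Ord ℓ) {f : A → Car Y} {g : Car Y → Car Z} where

  SegmentImage-∘ : isSimulation Y Z g → ∀ {y} → SegmentImage Y f y → SegmentImage Z (g ∘ f) (g y)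
  SegmentImage-∘ (g-mono , g-lift) {y} (f≺y , f-cover) = (λ x → g-mono _ _ (f≺y x)) , cover
    where
    cover : ∀ {z} → _≺_ Z z (g y) → fiber (g ∘ f) z
    cover z≺gy with g-lift y _ z≺gy
    ... | y₀ , y₀≺y , refl with f-cover y₀≺y
    ... | x , refl = x , refl

  SegmentImage-∘-surjective : (∀ y → fiber f y) →
                              ∀ {z} → SegmentImage Z g z → SegmentImage Z (g ∘ f) z
  SegmentImage-∘-surjective f-surj {z} (g≺z , g-cover) = (λ x → g≺z (f x)) , cover
    where
    cover : ∀ {z′} → _≺_ Z z′ z → fiber (g ∘ f) z′
    cover z′≺z with g-cover z′≺z
    ... | y , refl with f-surj y
    ... | x , refl = x , refl

<ₒ-≤ₒ-trans : ∀ {ℓ} (A B C : Ord ℓ) → A <ₒ B → B ≤ₒ C → A <ₒ C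
<ₒ-≤ₒ-trans A B C (f , f-sim , f-bdd) (g , g-sim) =
  SegmentImage⇒<ₒ A C (simulation-∘ A B f-sim C g-sim)
    (SegmentImage-∘ B C g-sim (bounded⇒SegmentImage A B f-bdd))

module Classical {ℓ} (lem : LEM ℓ) where

  decide : (P : Set ℓ) → isProp P → Dec P
  decide P P-prop = fromSum (lem P P-prop)

  module _ (X : Ord ℓ) where

    private
      _<_ = _≺_ X

    ≺-trichotomous : ∀ x y → x < y ⊎ x ≡ y ⊎ y < x
    ≺-trichotomous = ≺-rec X _ λ x ih-x → ≺-rec X _ λ y ih-y → compare x y ih-x ih-y
      where
      Cmp : Car X → Car X → Set ℓ
      Cmp x y = x < y ⊎ x ≡ y ⊎ y < x
      compare : ∀ x y → WfRec _<_ (λ x → ∀ y → Cmp x y) x → WfRec _<_ (Cmp x) y → Cmp x y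
      compare x y ih-x ih-y with decide (x < y) (≺-prop X x y) | decide (y < x) (≺-prop X y x)
      ... | yes x<y | _       = inj₁ x<y
      ... | no _    | yes y<x = inj₂ (inj₂ y<x)
      ... | no x≮y  | no y≮x  = inj₂ (inj₁ (ext X y x λ c → below-y c , below-x c))
        where
        below-y : ∀ c → c < y → c < x
        below-y c c<y with ih-y c<y
        ... | inj₁ x<c         = ⊥-elim (x≮y (trans X x<c c<y))
        ... | inj₂ (inj₁ refl) = ⊥-elim (x≮y c<y)
        ... | inj₂ (inj₂ c<x)  = c<x
        below-x : ∀ c → c < x → c < y
        below-x c c<x with ih-x c<x y
        ... | inj₁ c<y         = c<y
        ... | inj₂ (inj₁ refl) = ⊥-elim (y≮x c<x)
        ... | inj₂ (inj₂ y<c)  = ⊥-elim (y≮x (trans X y<c c<x))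

    _≟_ : ∀ (x y : Car X) → Dec (x ≡ y)
    x ≟ y with ≺-trichotomous x y
    ... | inj₁ x<y        = no λ { refl → ≺-irrefl X x x<y }
    ... | inj₂ (inj₁ x≡y) = yes x≡y
    ... | inj₂ (inj₂ y<x) = no λ { refl → ≺-irrefl X x y<x }

    -- Without function extensionality a ∀-stated minimality is not a proposition. Instead
    -- minimality is the tag False (below? s) of a decision of ∃Below made earlier in the
    -- well-founded recursion; tags are propositions and by trichotomy there is at most one
    -- minimal element, so LEM applies to Minimal.
    module _ {p} {P : Car X → Set p} (P? : ∀ x → Dec (P x)) where

      ∃Below : Car X → Set ℓ
      ∃Below b = Σ[ y ∈ Car X ] (y < b × False (P? y))

      Minimal : (S : Car X → Set ℓ) → (∀ {y} → S y → Dec (∃Below y)) → Set ℓ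
      Minimal S below? = Σ[ y ∈ Car X ] Σ[ s ∈ S y ] (False (P? y) × False (below? s))

      Minimal-prop : ∀ {S} (below? : ∀ {y} → S y → Dec (∃Below y)) →
                     (∀ y → isProp (S y)) → isProp (Minimal S below?)
      Minimal-prop below? S-prop (y₁ , s₁ , q₁ , m₁) (y₂ , s₂ , q₂ , m₂) with ≺-trichotomous y₁ y₂
      ... | inj₁ y₁<y₂       = ⊥-elim (toWitnessFalse m₂ (y₁ , y₁<y₂ , q₁))
      ... | inj₂ (inj₂ y₂<y₁) = ⊥-elim (toWitnessFalse m₁ (y₂ , y₂<y₁ , q₂))
      ... | inj₂ (inj₁ refl) with S-prop y₁ s₁ s₂ | T-irrelevant q₁ q₂
      ...   | refl | refl = cong (λ m → y₁ , s₁ , q₁ , m) (T-irrelevant m₁ m₂)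

      Minimal-intro : ∀ {S} (below? : ∀ {y} → S y → Dec (∃Below y)) →
                      (∀ {y z} → z < y → S y → S z) →
                      ∀ y → S y → False (P? y) → Minimal S below?
      Minimal-intro {S} below? S-down = ≺-rec X _ step
        where
        step : ∀ y → WfRec _<_ (λ y → S y → False (P? y) → Minimal S below?) y →
               S y → False (P? y) → Minimal S below?
        step y ih s q with below? s
        ... | yes (z , z<y , qz) = ih z<y (S-down z<y s) qz
        ... | no ∄z = y , s , q , fromWitnessFalse ∄z

      ∃Below? : ∀ b → Acc _<_ b → Dec (∃Below b)
      ∃Below? b (acc rs) =
        map′ (λ (y , y<b , q , _) → y , y<b , q)
             (λ (y , y<b , q) → Minimal-intro {_< b} below? (λ z<y y<b → trans X z<y y<b) y y<b q)
             (decide (Minimal (_< b) below?) (Minimal-prop below? (λ y → ≺-prop X y b)))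
        where
        below? : ∀ {y} → y < b → Dec (∃Below y)
        below? y<b = ∃Below? _ (rs y<b)

      all-or-least-counterexample : (∀ x → P x) ⊎ Σ[ x ∈ Car X ] (¬ P x × ∀ {y} → y < x → P y)
      all-or-least-counterexample
        with decide (Minimal (λ _ → ⊤) below?) (Minimal-prop below? (λ _ _ _ → refl))
        where
        below? : ∀ {y} → ⊤ → Dec (∃Below y)
        below? {y} _ = ∃Below? y (wf X y)
      ... | no ∄min = inj₁ λ x →
        decidable-stable (P? x) λ ¬Px → ∄min (Minimal-intro _ _ x _ (fromWitnessFalse ¬Px))
      ... | yes (x , _ , ¬Px , m) = inj₂ (x , toWitnessFalse ¬Px , λ {y} y<x →
        decidable-stable (P? y) λ ¬Py → toWitnessFalse m (y , y<x , fromWitnessFalse ¬Py))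

  module _ (X Y : Ord ℓ) {f : Car X → Car Y} (f-sim : isSimulation X Y f) where

    fiber-prop : ∀ y → isProp (fiber f y)
    fiber-prop y (x₁ , e₁) (x₂ , e₂)
      with simulation-injective X Y f-sim x₁ x₂ (≡-trans e₁ (sym e₂))
    ... | refl = cong (x₁ ,_) (Decidable⇒UIP.≡-irrelevant (_≟_ Y) e₁ e₂)

    surjective-or-SegmentImage : (∀ y → fiber f y) ⊎ Σ[ y ∈ Car Y ] SegmentImage Y f y
    surjective-or-SegmentImage
      with all-or-least-counterexample Y (λ y → decide (fiber f y) (fiber-prop y))
    ... | inj₁ surjective = inj₁ surjective
    ... | inj₂ (y , y∉f , cover) = inj₂ (y , f≺y , cover)
      where
      f≺y : ∀ x → _≺_ Y (f x) y
      f≺y x with ≺-trichotomous Y (f x) y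
      ... | inj₁ fx≺y        = fx≺y
      ... | inj₂ (inj₁ fx≡y) = ⊥-elim (y∉f (x , fx≡y))
      ... | inj₂ (inj₂ y≺fx) = let (x₀ , _ , fx₀≡y) = proj₂ f-sim x y y≺fx in ⊥-elim (y∉f (x₀ , fx₀≡y))

  ≤ₒ-<ₒ-trans : (A B C : Ord ℓ) → A ≤ₒ B → B <ₒ C → A <ₒ C
  ≤ₒ-<ₒ-trans A B C (f , f-sim) (g , g-sim , g-bdd) with surjective-or-SegmentImage A B f-sim
  ... | inj₁ f-surj =
    SegmentImage⇒<ₒ A C (simulation-∘ A B f-sim C g-sim)
      (SegmentImage-∘-surjective B C f-surj (bounded⇒SegmentImage B C g-bdd))
  ... | inj₂ (_ , f-seg) =
    SegmentImage⇒<ₒ A C (simulation-∘ A B f-sim C g-sim) (SegmentImage-∘ B C g-sim f-seg)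

module _ {ℓ : Level} where

  propOrd : (P : Set ℓ) → isProp P → Ord ℓ
  propOrd P P-prop = record
    { Car = P ; _≺_ = λ _ _ → ⊥ ; ≺-prop = λ _ _ ()
    ; ext = λ a b _ → P-prop b a ; wf = λ _ → acc λ () ; trans = λ () }

  𝟙 : Ord ℓ
  𝟙 = propOrd ⊤ (λ _ _ → refl)

  _<₂_ : Lift ℓ Bool → Lift ℓ Bool → Set ℓ
  lift a <₂ lift b = Lift ℓ (a <ᵇ b)

  <₂-acc : ∀ b → Acc _<₂_ (lift b)
  <₂-acc false = acc λ { {lift _} (lift ()) }
  <₂-acc true  = acc λ { {lift false} _ → <₂-acc false ; {lift true} (lift ()) }

  <₂-ext : ∀ a b → (∀ c → (c <₂ a → c <₂ b) × (c <₂ b → c <₂ a)) → b ≡ a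
  <₂-ext (lift false) (lift false) _ = refl
  <₂-ext (lift true)  (lift true)  _ = refl
  <₂-ext (lift false) (lift true)  h with proj₂ (h (lift false)) (lift f<t)
  ... | lift ()
  <₂-ext (lift true)  (lift false) h with proj₁ (h (lift false)) (lift f<t)
  ... | lift ()

  𝟚 : Ord ℓ
  𝟚 = record
    { Car = Lift ℓ Bool ; _≺_ = _<₂_
    ; ≺-prop = λ { (lift _) (lift _) (lift p) (lift q) → cong lift (<-irrelevant p q) }
    ; ext = <₂-ext ; wf = λ (lift b) → <₂-acc b
    ; trans = λ { {lift _} {lift _} {lift _} (lift p) (lift q) → lift (<-trans p q) } }

  propOrd≤𝟙 : (P : Set ℓ) (P-prop : isProp P) → propOrd P P-prop ≤ₒ 𝟙
  propOrd≤𝟙 P P-prop = (λ _ → _) , (λ _ _ ()) , (λ _ _ ())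

  𝟙<𝟚 : 𝟙 <ₒ 𝟚
  𝟙<𝟚 = SegmentImage⇒<ₒ 𝟙 𝟚 ((λ _ _ ()) , λ { _ (lift _) (lift ()) })
          ((λ _ → lift f<t) , λ { {lift false} _ → _ , refl ; {lift true} (lift ()) })

  ≤ₒ-<ₒ-trans⇒LEM : ((A B C : Ord ℓ) → A ≤ₒ B → B <ₒ C → A <ₒ C) → LEM ℓ
  ≤ₒ-<ₒ-trans⇒LEM ≤ₒ-<ₒ-trans P P-prop
    with ≤ₒ-<ₒ-trans (propOrd P P-prop) 𝟙 𝟚 (propOrd≤𝟙 P P-prop) 𝟙<𝟚
  ... | _ , _ , lift true  , _ , (inv , _) , _ = inj₁ (inv (lift false , lift f<t))
  ... | k , _ , lift false , k≺false , _       = inj₂ λ p → nothing-below-false (k p) (k≺false p)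
    where
    nothing-below-false : ∀ a → ¬ (a <₂ lift false)
    nothing-below-false (lift _) (lift ())

lemma7p1 : {ℓ : Level} →
    ((A B C : Ord ℓ) → A <ₒ B → B ≤ₒ C → A <ₒ C) ×
    (((A B C : Ord ℓ) → A ≤ₒ B → B <ₒ C → A <ₒ C) ⇔ LEM ℓ)
lemma7p1 = <ₒ-≤ₒ-trans , mk⇔ ≤ₒ-<ₒ-trans⇒LEM Classical.≤ₒ-<ₒ-trans
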